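{- Let $(\omega,E)$ be a weakly universal graph and let $\omega=A_0\cup\dots\cup A_{k-1}$ be a partition into finitely many sets. Then there is $i<k$ such that the induced subgraph $(\omega,E)\restriction_{A_i}$ is weakly universal.
   Context: A graph is weakly universal if it contains every finite graph as an induced subgraph (up to isomorphism). $(\omega,E)\restriction_A$ is the induced subgraph on $A$. -}

module Defs where

open import Data.Nat using (ℕ)
open import Data.Fin using (Fin)
open import Data.Unit using (⊤)
open import Data.Product using (Σ; _×_)
open import Function.Bundles using (_⇔_)
open import Function.Definitions using (Injective)
open import Relation.Binary.PropositionalEquality using (_≡_)
open import Relation.Nullary using (¬_)
open import Relation.Unary using (Pred)
open import Level using (0ℓ)

record Graphω : Set₁ where
  field
    E     : ℕ → ℕ → Set
    sym   : ∀ {x y} → E x y → E y x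
    irrefl : ∀ {x} → ¬ E x x

record FinGraph (n : ℕ) : Set₁ where
  field
    E     : Fin n → Fin n → Set
    sym   : ∀ {x y} → E x y → E y x
    irrefl : ∀ {x} → ¬ E x x

InducedEmbedsInto : ∀ {n} → FinGraph n → (Γ : Graphω) → Pred ℕ 0ℓ → Set
InducedEmbedsInto {n} G Γ A =
  Σ (Fin n → ℕ) λ f →
    Injective _≡_ _≡_ f
    × (∀ x → A (f x))
    × (∀ x y → FinGraph.E G x y ⇔ Graphω.E Γ (f x) (f y))

WeaklyUniversalOn : Graphω → Pred ℕ 0ℓ → Set₁
WeaklyUniversalOn Γ A = ∀ (n : ℕ) (G : FinGraph n) → InducedEmbedsInto G Γ A

WeaklyUniversal : Graphω → Set₁
WeaklyUniversal Γ = WeaklyUniversalOn Γ (λ _ → ⊤)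

-- The i-th part A_i of the partition of ω given by a colouring c : ω → k.
Part : ∀ {k} → (ℕ → Fin k) → Fin k → Pred ℕ 0ℓ
Part c i x = c x ≡ i

{-# OPTIONS --safe #-}
-- If neither S ∩ P nor S ∖ P is weakly universal, pick finite graphs G and H
-- that do not embed into them.  The lexicographic product G[H] embeds into S,
-- and either every copy of H in it meets P, so that one such vertex per copy
-- yields G inside S ∩ P, or some copy of H avoids P altogether.  Hence
-- (classically) splitting a weakly universal set into two decidable pieces
-- leaves one of them weakly universal, and induction over the colours gives
-- the corollary.
module Submission where

open import Defs
open import Data.Nat using (ℕ; _*_)
open import Data.Fin using (Fin; zero; combine; remQuot; _≟_)
open import Data.Fin.Properties
  using (any?; all?; ¬∀⟶∃¬; remQuot-combine; combine-injectiveˡ; combine-injectiveʳ)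
open import Data.Product using (Σ; _×_; _,_; proj₁; proj₂; curry)
open import Data.Sum using (_⊎_; inj₁; inj₂; [_,_]) renaming (map to ⊎-map)
open import Data.Empty using (⊥; ⊥-elim)
open import Data.List using (List; []; _∷_; allFin)
open import Data.List.Membership.Propositional using (_∈_)
open import Data.List.Membership.Propositional.Properties using (∈-allFin)
open import Data.List.Relation.Unary.Any using (here; there)
open import Function.Base using (id; _∘_)
open import Function.Bundles using (_⇔_; mk⇔)
open import Function.Definitions using (Injective)
open import Function.Properties.Equivalence using () renaming (trans to ⇔-trans)
open import Relation.Binary.PropositionalEquality using (_≡_; refl; subst₂; sym)
open import Relation.Nullary using (Dec; yes; no)
open import Relation.Nullary.Decidable using (map′)
open import Relation.Unary using (Pred; Decidable; Satisfiable; U; _⊆_; _∩_; ∁)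
open import Axiom.ExcludedMiddle using (ExcludedMiddle)
open import Level using (Level; 0ℓ; _⊔_; Lift; lift; lower)

private
  variable
    a b p q : Level
    n m k : ℕ
    S T P : Pred ℕ 0ℓ

lower-excludedMiddle : ExcludedMiddle (a ⊔ b) → ExcludedMiddle a
lower-excludedMiddle {b = b} em = map′ lower lift (em {Lift b _})

∀∀⊎⇒∀⊎∀ : {A : Set a} {B : Set b} {P : A → Set p} {Q : B → Set q} →
  Dec (∀ x → P x) → (∀ y → Dec (Q y)) →
  (∀ x y → P x ⊎ Q y) → (∀ x → P x) ⊎ (∀ y → Q y)
∀∀⊎⇒∀⊎∀ (yes ∀P) Q? P⊎Q = inj₁ ∀P
∀∀⊎⇒∀⊎∀ {Q = Q} (no ¬∀P) Q? P⊎Q = inj₂ Q-holds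
  where
  Q-holds : ∀ y → Q y
  Q-holds y with Q? y
  ... | yes q = q
  ... | no ¬q = ⊥-elim (¬∀P (λ x → [ id , ⊥-elim ∘ ¬q ] (P⊎Q x y)))

InducedEmbedding : FinGraph n → FinGraph m → Set
InducedEmbedding {n} {m} G H =
  Σ (Fin n → Fin m) λ g →
    Injective _≡_ _≡_ g × (∀ x y → FinGraph.E G x y ⇔ FinGraph.E H (g x) (g y))

K₁ : FinGraph 1
K₁ = record { E = λ _ _ → ⊥ ; sym = λ () ; irrefl = λ () }

module _ (G : FinGraph n) (H : FinGraph m) where
  private
    module G = FinGraph G
    module H = FinGraph H

  LexEdge : Fin n × Fin m → Fin n × Fin m → Set
  LexEdge (i , j) (i′ , j′) = G.E i i′ ⊎ (i ≡ i′ × H.E j j′)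

  private
    LexEdge-sym : ∀ u v → LexEdge u v → LexEdge v u
    LexEdge-sym _ _ (inj₁ e)          = inj₁ (G.sym e)
    LexEdge-sym _ _ (inj₂ (refl , e)) = inj₂ (refl , H.sym e)

    LexEdge-irrefl : ∀ u → LexEdge u u → ⊥
    LexEdge-irrefl _ (inj₁ e)       = G.irrefl e
    LexEdge-irrefl _ (inj₂ (_ , e)) = H.irrefl e

  -- The lexicographic product G[H], with the vertex (i , j) encoded as combine i j.
  lexProduct : FinGraph (n * m)
  lexProduct = record
    { E      = λ x y → LexEdge (remQuot m x) (remQuot m y)
    ; sym    = λ {x} {y} → LexEdge-sym (remQuot m x) (remQuot m y)
    ; irrefl = λ {x} → LexEdge-irrefl (remQuot m x)
    }

  lexProduct-edge : ∀ i j i′ j′ →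
    LexEdge (i , j) (i′ , j′) ⇔ FinGraph.E lexProduct (combine i j) (combine i′ j′)
  lexProduct-edge i j i′ j′ = mk⇔
    (subst₂ LexEdge (sym (remQuot-combine i j)) (sym (remQuot-combine i′ j′)))
    (subst₂ LexEdge (remQuot-combine i j) (remQuot-combine i′ j′))

  transversal-embedding : (s : Fin n → Fin m) → InducedEmbedding G lexProduct
  transversal-embedding s =
    (λ i → combine i (s i)) ,
    (λ {i} {i′} eq → combine-injectiveˡ i (s i) i′ (s i′) eq) ,
    (λ i i′ → ⇔-trans (mk⇔ inj₁ G-edge) (lexProduct-edge i (s i) i′ (s i′)))
    where
    G-edge : ∀ {i i′} → LexEdge (i , s i) (i′ , s i′) → G.E i i′
    G-edge (inj₁ e)          = e
    G-edge (inj₂ (refl , e)) = ⊥-elim (H.irrefl e)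

  fibre-embedding : (i : Fin n) → InducedEmbedding H lexProduct
  fibre-embedding i =
    combine i ,
    (λ {j} {j′} eq → combine-injectiveʳ i j i j′ eq) ,
    (λ j j′ → ⇔-trans (mk⇔ (λ e → inj₂ (refl , e)) H-edge) (lexProduct-edge i j i j′))
    where
    H-edge : ∀ {j j′} → LexEdge (i , j) (i , j′) → H.E j j′
    H-edge (inj₁ e)       = ⊥-elim (G.irrefl e)
    H-edge (inj₂ (_ , e)) = e

module _ (Γ : Graphω) where
  inducedEmbedsInto-∘ : {G : FinGraph n} {H : FinGraph m} →
    (e : InducedEmbedsInto H Γ S) (g : InducedEmbedding G H) →
    (∀ x → T (proj₁ e (proj₁ g x))) → InducedEmbedsInto G Γ (S ∩ T)
  inducedEmbedsInto-∘ (f , f-inj , f∈S , f-edge) (g , g-inj , g-edge) f∘g∈T =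
    f ∘ g , g-inj ∘ f-inj , (λ x → f∈S (g x) , f∘g∈T x) ,
    λ x y → ⇔-trans (g-edge x y) (f-edge (g x) (g y))

  inducedEmbedsInto-mono : {G : FinGraph n} →
    S ⊆ T → InducedEmbedsInto G Γ S → InducedEmbedsInto G Γ T
  inducedEmbedsInto-mono S⊆T (f , f-inj , f∈S , f-edge) = f , f-inj , S⊆T ∘ f∈S , f-edge

  weaklyUniversalOn-mono : S ⊆ T → WeaklyUniversalOn Γ S → WeaklyUniversalOn Γ T
  weaklyUniversalOn-mono {S = S} {T = T} S⊆T wu n G =
    inducedEmbedsInto-mono {S = S} {T = T} {G = G} S⊆T (wu n G)

  weaklyUniversalOn⇒satisfiable : WeaklyUniversalOn Γ S → Satisfiable S
  weaklyUniversalOn⇒satisfiable wu with wu 1 K₁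
  ... | f , _ , f∈S , _ = f zero , f∈S zero

  lexProduct-split : (G : FinGraph n) (H : FinGraph m) → Decidable P →
    InducedEmbedsInto (lexProduct G H) Γ S →
    InducedEmbedsInto G Γ (S ∩ P) ⊎ InducedEmbedsInto H Γ (S ∩ ∁ P)
  lexProduct-split {n = n} {P = P} {S = S} G H P? e@(f , _)
    with all? (λ i → any? (λ j → P? (f (combine i j))))
  ... | yes every-copy-meets =
    inj₁ (inducedEmbedsInto-∘ {S = S} {T = P} {G = G} {H = lexProduct G H}
            e (transversal-embedding G H (proj₁ ∘ every-copy-meets))
            (proj₂ ∘ every-copy-meets))
  ... | no ¬every-copy-meets
    with ¬∀⟶∃¬ n _ (λ i → any? (λ j → P? (f (combine i j)))) ¬every-copy-meets
  ... | i , copy-misses =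
    inj₂ (inducedEmbedsInto-∘ {S = S} {T = ∁ P} {G = H} {H = lexProduct G H}
            e (fibre-embedding G H i)
            (λ j p → copy-misses (j , p)))

  weaklyUniversalOn-split : ExcludedMiddle (Level.suc 0ℓ) → (S : Pred ℕ 0ℓ) →
    Decidable P → WeaklyUniversalOn Γ S →
    WeaklyUniversalOn Γ (S ∩ P) ⊎ WeaklyUniversalOn Γ (S ∩ ∁ P)
  weaklyUniversalOn-split {P = P} em S P? wu =
    ⊎-map curry curry
      (∀∀⊎⇒∀⊎∀ {P = λ (n , G) → InducedEmbedsInto G Γ (S ∩ P)}
               {Q = λ (m , H) → InducedEmbedsInto H Γ (S ∩ ∁ P)}
        em (λ _ → lower-excludedMiddle em)
        (λ (n , G) (m , H) → lexProduct-split {P = P} {S = S} G H P? (wu _ (lexProduct G H))))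

  weaklyUniversalOn-colour : ExcludedMiddle (Level.suc 0ℓ) → (S : Pred ℕ 0ℓ) →
    (c : ℕ → Fin k) (L : List (Fin k)) → S ⊆ (λ x → c x ∈ L) →
    WeaklyUniversalOn Γ S → Σ (Fin k) λ i → WeaklyUniversalOn Γ (S ∩ Part c i)
  weaklyUniversalOn-colour em S c [] covered wu
    with weaklyUniversalOn⇒satisfiable {S = S} wu
  ... | x , x∈S with covered x∈S
  ... | ()
  weaklyUniversalOn-colour em S c (i ∷ L) covered wu
    with weaklyUniversalOn-split em S (λ x → c x ≟ i) wu
  ... | inj₁ wuᵢ = i , wuᵢ
  ... | inj₂ wu-rest
    with weaklyUniversalOn-colour em (S ∩ ∁ (Part c i)) c L covered-rest wu-rest
    where
    covered-rest : S ∩ ∁ (Part c i) ⊆ λ x → c x ∈ L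
    covered-rest (x∈S , cx≢i) with covered x∈S
    ... | here cx≡i = ⊥-elim (cx≢i cx≡i)
    ... | there cx∈L = cx∈L
  ... | j , wuⱼ =
    j , weaklyUniversalOn-mono {S = (S ∩ ∁ (Part c i)) ∩ Part c j} {T = S ∩ Part c j}
          (λ ((x∈S , _) , cx≡j) → x∈S , cx≡j) wuⱼ

corollary4p2 : ExcludedMiddle (Level.suc 0ℓ) → (Γ : Graphω) → WeaklyUniversal Γ →
    (k : ℕ) (c : ℕ → Fin k) → Σ (Fin k) λ i → WeaklyUniversalOn Γ (Part c i)
corollary4p2 em Γ wu k c
  with weaklyUniversalOn-colour Γ em U c (allFin k) (λ {x} _ → ∈-allFin (c x)) wu
... | i , wuᵢ = i , weaklyUniversalOn-mono Γ {S = U ∩ Part c i} {T = Part c i} proj₂ wuᵢ
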